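{- Let $G$ be a connected $k$-regular graph on $n$ vertices with $k\ge3$, diameter $D\ge3$, and girth $g$. Then $g\le n/2$. -}

module Defs where

open import Data.Nat using (ℕ; zero; suc; _≤_; _<_; _≥_)
open import Data.Fin using (Fin; zero; suc; toℕ; fromℕ; inject₁)
open import Data.Bool using (Bool; true; false)
open import Data.Product using (Σ; _×_; ∃; _,_)
open import Data.List using (length; filter; allFin)
open import Data.Bool using (T)
open import Data.Bool.Properties using (T?)
open import Relation.Binary.PropositionalEquality using (_≡_; _≢_)
open import Function.Definitions using (Injective)

record Graph (n : ℕ) : Set where
  field
    adj     : Fin n → Fin n → Bool
    sym     : ∀ i j → adj i j ≡ adj j i
    irrefl  : ∀ i → adj i i ≡ false

open Graph public

Adj : ∀ {n} → Graph n → Fin n → Fin n → Set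
Adj G i j = adj G i j ≡ true

degree : ∀ {n} → Graph n → Fin n → ℕ
degree {n} G i = length (filter (λ j → T? (adj G i j)) (allFin n))

IsRegular : ∀ {n} → Graph n → ℕ → Set
IsRegular G k = ∀ i → degree G i ≡ k

record Walk {n} (G : Graph n) (u v : Fin n) (d : ℕ) : Set where
  field
    vert  : Fin (suc d) → Fin n
    start : vert zero ≡ u
    end   : vert (fromℕ d) ≡ v
    step  : ∀ (i : Fin d) → Adj G (vert (inject₁ i)) (vert (suc i))

IsConnected : ∀ {n} → Graph n → Set
IsConnected G = ∀ u v → ∃ λ d → Walk G u v d

Distance : ∀ {n} → Graph n → Fin n → Fin n → ℕ → Set
Distance G u v d = Walk G u v d × (∀ d' → Walk G u v d' → d ≤ d')

Diameter : ∀ {n} → Graph n → ℕ → Set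
Diameter G D =
  (∀ u v d → Distance G u v d → d ≤ D) ×
  (∃ λ u → ∃ λ v → Distance G u v D)

record Cycle {n} (G : Graph n) (ℓ : ℕ) : Set where
  field
    len≥3 : 3 ≤ ℓ
    m     : ℕ
    ℓ≡    : ℓ ≡ suc m
    vert  : Fin (suc m) → Fin n
    inj   : Injective _≡_ _≡_ vert
    step  : ∀ (i : Fin m) → Adj G (vert (inject₁ i)) (vert (suc i))
    close : Adj G (vert (fromℕ m)) (vert zero)

Girth : ∀ {n} → Graph n → ℕ → Set
Girth G g = Cycle G g × (∀ ℓ → Cycle G ℓ → g ≤ ℓ)

module Submission where

-- If g ≤ 4: two vertices u, v at distance D ≥ 3 have disjoint closed
-- neighbourhoods of size k + 1 each, so n ≥ 2(k + 1) ≥ 8 ≥ 2g  (farApart).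
--
-- If g ≥ 5: take a shortest cycle c 0, …, c (g - 1), indexed periodically by ℕ
-- (module CycleSequence).  Minimality forbids chords and forbids any outside
-- vertex adjacent to two cycle vertices close together along the cycle.  Each
-- c i has a neighbour x i besides its two cycle neighbours (degree ≥ 3); x i lies
-- off the cycle (no chords), and the x i are pairwise distinct, since a shared
-- x i = x j would close a cycle through the shorter arc between c i and c j, of
-- length at most g/2 + 2 < g.  These 2g distinct vertices give 2g ≤ n.

open import Defs hiding (sym)
open import Data.Nat using (ℕ; zero; suc; pred; _+_; _*_; _≤_; _<_; z≤n; s≤s; s≤s⁻¹; NonZero)
open import Data.Nat.Properties
open import Data.Nat.DivMod
  using (_%_; _/_; m≡m%n+[m/n]*n; [m+kn]%n≡m%n; [m+n]%n≡m%n; m*n%n≡0; m<n⇒m%n≡m; n%n≡0; m%n<n; %-distribˡ-+; m%n%n≡m%n)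
open import Data.Fin using (Fin; zero; suc; toℕ; fromℕ; fromℕ<; inject₁)
open import Data.Fin.Properties using (injective⇒≤; toℕ-injective; toℕ-fromℕ<; toℕ-fromℕ; toℕ-inject₁; toℕ<n)
import Data.Fin.Properties as Fin
open import Data.Bool.Properties using (T?; T-≡)
open import Data.List using (List; []; _∷_; length; lookup; filter; allFin; applyUpTo; _++_)
open import Data.List.Properties using (length-++; length-applyUpTo)
open import Data.List.Membership.Propositional using (_∈_)
open import Data.List.Membership.Propositional.Properties using (∈-lookup; ∈-filter⁻; ∈-applyUpTo⁻)
open import Data.List.Relation.Unary.All as All using (_∷_)
open import Data.List.Relation.Unary.AllPairs using (_∷_)
open import Data.List.Relation.Unary.Any using (here; there)
open import Data.List.Relation.Unary.Unique.Propositional using (Unique)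
open import Data.List.Relation.Unary.Unique.Propositional.Properties using (++⁺; filter⁺; allFin⁺; applyUpTo⁺₁)
open import Data.List.Relation.Binary.Disjoint.Propositional using (Disjoint)
open import Data.Product using (∃; _×_; _,_; proj₁; proj₂)
open import Data.Sum using (_⊎_; inj₁; inj₂; [_,_]′)
open import Data.Empty using (⊥; ⊥-elim)
open import Function using (_∘_)
open import Function.Bundles using (Equivalence)
open import Relation.Nullary using (yes; no; contradiction)
open import Relation.Binary.PropositionalEquality

lookup-injective : ∀ {A : Set} {xs : List A} → Unique xs →
                   ∀ {i j} → lookup xs i ≡ lookup xs j → i ≡ j
lookup-injective (_ ∷ _) {zero} {zero} _ = refl
lookup-injective (x≢ ∷ _) {zero} {suc j} eq = contradiction eq (All.lookup x≢ (∈-lookup j))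
lookup-injective (x≢ ∷ _) {suc i} {zero} eq = contradiction (sym eq) (All.lookup x≢ (∈-lookup i))
lookup-injective (_ ∷ u) {suc i} {suc j} eq = cong suc (lookup-injective u eq)

unique⇒length≤ : ∀ {n} {xs : List (Fin n)} → Unique xs → length xs ≤ n
unique⇒length≤ u = injective⇒≤ (lookup-injective u)

avoidTwo : ∀ {n} {xs : List (Fin n)} → Unique xs → 3 ≤ length xs →
           ∀ a b → ∃ λ y → y ∈ xs × a ≢ y × b ≢ y
avoidTwo {xs = []}          _ ()
avoidTwo {xs = _ ∷ []}      _ (s≤s ())
avoidTwo {xs = _ ∷ _ ∷ []}  _ (s≤s (s≤s ()))
avoidTwo {xs = x ∷ y ∷ z ∷ _} ((x≢y ∷ x≢z ∷ _) ∷ (y≢z ∷ _) ∷ _) _ a b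
  with a Fin.≟ x | b Fin.≟ x
... | no a≢x   | no b≢x = x , here refl , a≢x , b≢x
... | yes refl | _ with b Fin.≟ y
...   | yes refl = z , there (there (here refl)) , x≢z , y≢z
...   | no b≢y   = y , there (here refl) , x≢y , b≢y
avoidTwo {xs = x ∷ y ∷ z ∷ _} ((x≢y ∷ x≢z ∷ _) ∷ (y≢z ∷ _) ∷ _) _ a b
  | no a≢x | yes refl with a Fin.≟ y
...   | yes refl = z , there (there (here refl)) , y≢z , x≢z
...   | no a≢y   = y , there (here refl) , a≢y , x≢y

%-offset-zero : ∀ a e d .{{_ : NonZero d}} → e < d → (a + e) % d ≡ a % d → e ≡ 0
%-offset-zero a e d e<d same = begin
  e                    ≡⟨ m<n⇒m%n≡m e<d ⟨
  e % d                ≡⟨ [m+kn]%n≡m%n e (a / d) d ⟨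
  (e + a / d * d) % d  ≡⟨ cong (_% d) (+-cancelˡ-≡ (a % d) _ _ quotients) ⟩
  ((a + e) / d * d) % d ≡⟨ m*n%n≡0 ((a + e) / d) d ⟩
  0                    ∎
  where
  open ≡-Reasoning
  quotients : a % d + (e + a / d * d) ≡ a % d + (a + e) / d * d
  quotients = begin
    a % d + (e + a / d * d)   ≡⟨ cong (a % d +_) (+-comm e _) ⟩
    a % d + (a / d * d + e)   ≡⟨ +-assoc (a % d) _ e ⟨
    a % d + a / d * d + e     ≡⟨ cong (_+ e) (m≡m%n+[m/n]*n a d) ⟨
    a + e                     ≡⟨ m≡m%n+[m/n]*n (a + e) d ⟩
    (a + e) % d + (a + e) / d * d ≡⟨ cong (_+ (a + e) / d * d) same ⟩
    a % d + (a + e) / d * d   ∎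

%-window-injective : ∀ r d .{{_ : NonZero d}} {s t} → s < d → t < d →
                     (r + s) % d ≡ (r + t) % d → s ≡ t
%-window-injective r d {s} {t} s<d t<d same =
  [ ordered s<d t<d same , (λ t≤s → sym (ordered t<d s<d (sym same) t≤s)) ]′ (≤-total s t)
  where
  ordered : ∀ {s t} → s < d → t < d → (r + s) % d ≡ (r + t) % d → s ≤ t → s ≡ t
  ordered {s} {t} _ t<d same s≤t with e , refl ← m≤n⇒∃[o]m+o≡n s≤t =
    sym (trans (cong (s +_) e≡0) (+-identityʳ s))
    where
    e≡0 : e ≡ 0
    e≡0 = %-offset-zero (r + s) e d (≤-<-trans (m≤n+m e s) t<d)
            (trans (cong (_% d) (+-assoc r s e)) (sym same))

%-suc : ∀ i d .{{_ : NonZero d}} → suc i % d ≡ suc (i % d) % d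
%-suc i d = trans (cong (λ x → suc x % d) (m≡m%n+[m/n]*n i d)) ([m+kn]%n≡m%n (suc (i % d)) (i / d) d)

%-reach : ∀ m r t → ∃ λ e → e < suc m × (r + e) % suc m ≡ t % suc m
%-reach m r t = e , m%n<n (t + m * r) d , (begin
  (r + e) % d                 ≡⟨ %-distribˡ-+ r e d ⟩
  (r % d + e % d) % d         ≡⟨ cong (λ x → (r % d + x) % d) (m%n%n≡m%n (t + m * r) d) ⟩
  (r % d + (t + m * r) % d) % d ≡⟨ %-distribˡ-+ r (t + m * r) d ⟨
  (r + (t + m * r)) % d       ≡⟨ cong (_% d) shuffle ⟩
  (t + r * d) % d             ≡⟨ [m+kn]%n≡m%n t r d ⟩
  t % d                       ∎)
  where
  open ≡-Reasoning
  d = suc m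
  e = (t + m * r) % d
  shuffle : r + (t + m * r) ≡ t + r * d
  shuffle = begin
    r + (t + m * r)   ≡⟨ +-assoc r t _ ⟨
    r + t + m * r     ≡⟨ cong (_+ m * r) (+-comm r t) ⟩
    t + r + m * r     ≡⟨ +-assoc t r _ ⟩
    t + (r + m * r)   ≡⟨ cong (λ x → t + (r + x)) (*-comm m r) ⟩
    t + (r + r * m)   ≡⟨ cong (t +_) (*-suc r m) ⟨
    t + r * d         ∎

adj-sym : ∀ {n} (G : Graph n) {i j} → Adj G i j → Adj G j i
adj-sym G {i} {j} a = trans (Graph.sym G j i) a

adj-irrefl : ∀ {n} (G : Graph n) {i j} → Adj G i j → i ≢ j
adj-irrefl G {i} a refl with () ← trans (sym a) (Graph.irrefl G i)

module _ {n} (G : Graph n) where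

  nbrs : Fin n → List (Fin n)
  nbrs i = filter (λ j → T? (adj G i j)) (allFin n)

  ∈nbrs⇒Adj : ∀ {i j} → j ∈ nbrs i → Adj G i j
  ∈nbrs⇒Adj {i} p = Equivalence.to T-≡ (proj₂ (∈-filter⁻ (λ j → T? (adj G i j)) {xs = allFin n} p))

  nbrs-unique : ∀ i → Unique (nbrs i)
  nbrs-unique i = filter⁺ _ (allFin⁺ n)

  closedNbhd : Fin n → List (Fin n)
  closedNbhd i = i ∷ nbrs i

  closedNbhd-unique : ∀ i → Unique (closedNbhd i)
  closedNbhd-unique i = All.tabulate (adj-irrefl G ∘ ∈nbrs⇒Adj) ∷ nbrs-unique i

  ∈closedNbhd : ∀ {i j} → j ∈ closedNbhd i → i ≡ j ⊎ Adj G i j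
  ∈closedNbhd (here refl) = inj₁ refl
  ∈closedNbhd (there p)   = inj₂ (∈nbrs⇒Adj p)

  stay : ∀ {u} → Walk G u u 0
  stay {u} = record { vert = λ _ → u ; start = refl ; end = refl ; step = λ () }

  edge : ∀ {u v} → Adj G u v → Walk G u v 1
  edge {u} {v} a = record { vert = vt ; start = refl ; end = refl ; step = λ { zero → a } }
    where
    vt : Fin 2 → Fin n
    vt zero    = u
    vt (suc _) = v

  twoStep : ∀ {u w v} → Adj G u w → Adj G w v → Walk G u v 2
  twoStep {u} {w} {v} a b =
    record { vert = vt ; start = refl ; end = refl ; step = λ { zero → a ; (suc zero) → b } }
    where
    vt : Fin 3 → Fin n
    vt zero          = u
    vt (suc zero)    = w
    vt (suc (suc _)) = v

  meet⇒shortWalk : ∀ {u v w} → w ∈ closedNbhd u → w ∈ closedNbhd v →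
                   ∃ λ d → d ≤ 2 × Walk G u v d
  meet⇒shortWalk p q with ∈closedNbhd p | ∈closedNbhd q
  ... | inj₁ refl | inj₁ refl = 0 , z≤n , stay
  ... | inj₁ refl | inj₂ vu   = 1 , s≤s z≤n , edge (adj-sym G vu)
  ... | inj₂ uv   | inj₁ refl = 1 , s≤s z≤n , edge uv
  ... | inj₂ uw   | inj₂ vw   = 2 , s≤s (s≤s z≤n) , twoStep uw (adj-sym G vw)

  farApart : ∀ {u v} → (∀ d → d ≤ 2 → Walk G u v d → ⊥) →
             suc (degree G u) + suc (degree G v) ≤ n
  farApart {u} {v} noShortWalk =
    subst (_≤ n) (length-++ (closedNbhd u))
      (unique⇒length≤ (++⁺ (closedNbhd-unique u) (closedNbhd-unique v) disjoint))
    where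
    disjoint : Disjoint (closedNbhd u) (closedNbhd v)
    disjoint (p , q) = let (d , d≤2 , w) = meet⇒shortWalk p q in noShortWalk d d≤2 w

  distance≥3⇒noShortWalk : ∀ {u v D} → Distance G u v D → 3 ≤ D →
                            ∀ d → d ≤ 2 → Walk G u v d → ⊥
  distance≥3⇒noShortWalk (_ , shortest) 3≤D d d≤2 w = <⇒≱ (≤-trans (s≤s d≤2) 3≤D) (shortest d w)

  closedPath⇒Cycle : ∀ L → 3 ≤ L → (f : ℕ → Fin n) →
                     (∀ {s t} → s < L → t < L → f s ≡ f t → s ≡ t) →
                     (∀ {s} → suc s < L → Adj G (f s) (f (suc s))) →
                     Adj G (f (pred L)) (f 0) → Cycle G L
  closedPath⇒Cycle (suc L) 3≤L f f-inj f-step f-close = record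
    { len≥3 = 3≤L ; m = L ; ℓ≡ = refl ; vert = f ∘ toℕ
    ; inj   = λ {i} {j} e → toℕ-injective (f-inj (toℕ<n i) (toℕ<n j) e)
    ; step  = λ i → subst (λ p → Adj G (f p) (f (suc (toℕ i)))) (sym (toℕ-inject₁ i))
                            (f-step (s≤s (toℕ<n i)))
    ; close = subst (λ p → Adj G (f p) (f 0)) (sym (toℕ-fromℕ L)) f-close
    }

module CycleSequence {n} {G : Graph n} {ℓ} (C : Cycle G ℓ) where
  open Cycle C using (m; vert; inj; step; close)

  at : (p : ℕ) → .(p < suc m) → Fin n
  at p p<g = vert (fromℕ< p<g)

  at-cong : ∀ {p q} .{hp : p < suc m} .{hq : q < suc m} → p ≡ q → at p hp ≡ at q hq
  at-cong refl = refl

  at-next : ∀ p (p<g : p < suc m) → Adj G (at p p<g) (at (suc p % suc m) (m%n<n (suc p) (suc m)))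
  at-next p p<g with m≤n⇒m<n∨m≡n (s≤s⁻¹ p<g)
  ... | inj₁ p<m = subst₂ (λ u v → Adj G (vert u) v) inject-fromℕ< next (step (fromℕ< p<m))
    where
    inject-fromℕ< : inject₁ (fromℕ< p<m) ≡ fromℕ< p<g
    inject-fromℕ< = toℕ-injective (trans (toℕ-inject₁ _) (trans (toℕ-fromℕ< p<m) (sym (toℕ-fromℕ< p<g))))
    next : at (suc p) (s≤s p<m) ≡ at (suc p % suc m) (m%n<n (suc p) (suc m))
    next = at-cong {hp = s≤s p<m} {hq = m%n<n (suc p) (suc m)} (sym (m<n⇒m%n≡m (s≤s p<m)))
  ... | inj₂ refl = subst₂ (λ u v → Adj G (vert u) v) last-fromℕ< wrap close
    where
    wrap : at 0 (s≤s z≤n) ≡ at (suc m % suc m) (m%n<n (suc m) (suc m))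
    wrap = at-cong {hp = s≤s z≤n} {hq = m%n<n (suc m) (suc m)} (sym (n%n≡0 (suc m)))
    last-fromℕ< : fromℕ m ≡ fromℕ< p<g
    last-fromℕ< = toℕ-injective (trans (toℕ-fromℕ m) (sym (toℕ-fromℕ< p<g)))

  cyc : ℕ → Fin n
  cyc i = at (i % suc m) (m%n<n i (suc m))

  cyc-step : ∀ i → Adj G (cyc i) (cyc (suc i))
  cyc-step i = subst (Adj G (cyc i)) (at-cong (sym (%-suc i (suc m))))
                     (at-next (i % suc m) (m%n<n i (suc m)))

  cyc-cong : ∀ i j → i % suc m ≡ j % suc m → cyc i ≡ cyc j
  cyc-cong i j = at-cong

  cyc-injective : ∀ i j → cyc i ≡ cyc j → i % suc m ≡ j % suc m
  cyc-injective i j e = begin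
    i % suc m                         ≡⟨ toℕ-fromℕ< (m%n<n i (suc m)) ⟨
    toℕ (fromℕ< (m%n<n i (suc m)))    ≡⟨ cong toℕ (inj e) ⟩
    toℕ (fromℕ< (m%n<n j (suc m)))    ≡⟨ toℕ-fromℕ< (m%n<n j (suc m)) ⟩
    j % suc m                         ∎
    where open ≡-Reasoning

module ShortestCycle {n} {G : Graph n} (3≤degree : ∀ i → 3 ≤ degree G i)
                     {g} (C : Cycle G g) (minimal : ∀ ℓ → Cycle G ℓ → g ≤ ℓ) (5≤g : 5 ≤ g) where
  open CycleSequence C
  open Cycle C using (m; ℓ≡)

  4≤m : 4 ≤ m
  4≤m = s≤s⁻¹ (subst (5 ≤_) ℓ≡ 5≤g)

  shorter : ∀ {L} → Cycle G L → L ≤ m → ⊥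
  shorter {L} c L≤m = <⇒≱ (s≤s L≤m) (subst (_≤ L) ℓ≡ (minimal L c))

  arc-step : ∀ r s → Adj G (cyc (r + s)) (cyc (r + suc s))
  arc-step r s = subst (λ t → Adj G (cyc (r + s)) (cyc t)) (sym (+-suc r s)) (cyc-step (r + s))

  arc-injective : ∀ r {s t} → s < suc m → t < suc m → cyc (r + s) ≡ cyc (r + t) → s ≡ t
  arc-injective r {s} {t} s<g t<g e =
    %-window-injective r (suc m) s<g t<g (cyc-injective (r + s) (r + t) e)

  -- A chord cyc r ~ cyc (r + d) with 2 ≤ d < m would close the shorter cycle
  -- cyc r, …, cyc (r + d).
  noChord : ∀ r d → 2 ≤ d → d < m → Adj G (cyc r) (cyc (r + d)) → ⊥
  noChord r d 2≤d d<m chord =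
    shorter (closedPath⇒Cycle G (suc d) (s≤s 2≤d) (λ s → cyc (r + s)) inj (λ {s} _ → arc-step r s) close) d<m
    where
    inj : ∀ {s t} → s < suc d → t < suc d → cyc (r + s) ≡ cyc (r + t) → s ≡ t
    inj s<L t<L = arc-injective r (≤-trans s<L (s≤s (<⇒≤ d<m))) (≤-trans t<L (s≤s (<⇒≤ d<m)))
    close : Adj G (cyc (r + d)) (cyc (r + 0))
    close = subst (λ t → Adj G (cyc (r + d)) (cyc t)) (sym (+-identityʳ r)) (adj-sym G chord)

  cycleNeighbours : ∀ i e → e < suc m → Adj G (cyc i) (cyc (i + e)) → e ≡ 1 ⊎ e ≡ m
  cycleNeighbours i zero          _   a = ⊥-elim (adj-irrefl G a (cong cyc (sym (+-identityʳ i))))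
  cycleNeighbours i (suc zero)    _   _ = inj₁ refl
  cycleNeighbours i (suc (suc e)) e<g a with m≤n⇒m<n∨m≡n (s≤s⁻¹ e<g)
  ... | inj₁ e<m = ⊥-elim (noChord i (suc (suc e)) (s≤s (s≤s z≤n)) e<m a)
  ... | inj₂ e≡m = inj₂ e≡m

  outward : ∀ i → ∃ λ x → x ∈ nbrs G (cyc i) × cyc (i + m) ≢ x × cyc (suc i) ≢ x
  outward i = avoidTwo (nbrs-unique G (cyc i)) (3≤degree (cyc i)) (cyc (i + m)) (cyc (suc i))

  out : ℕ → Fin n
  out i = proj₁ (outward i)

  out-adj : ∀ i → Adj G (cyc i) (out i)
  out-adj i = ∈nbrs⇒Adj G (proj₁ (proj₂ (outward i)))

  out-prev : ∀ i → cyc (i + m) ≢ out i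
  out-prev i = proj₁ (proj₂ (proj₂ (outward i)))

  out-next : ∀ i → cyc (suc i) ≢ out i
  out-next i = proj₂ (proj₂ (proj₂ (outward i)))

  -- The chosen neighbour lies off the cycle: by cycleNeighbours it could only be
  -- one of the two cycle neighbours, which were excluded.
  out-notAhead : ∀ i e → e < suc m → cyc (i + e) ≢ out i
  out-notAhead i e e<g onCycle with cycleNeighbours i e e<g (subst (Adj G (cyc i)) (sym onCycle) (out-adj i))
  ... | inj₁ refl = out-next i (trans (cong cyc (+-comm 1 i)) onCycle)
  ... | inj₂ refl = out-prev i onCycle

  offCycle : ∀ i t → cyc t ≢ out i
  offCycle i t t≡out =
    let (e , e<g , same) = %-reach m i t in
    out-notAhead i e e<g (trans (cyc-cong (i + e) t same) t≡out)

  -- A vertex x off the cycle adjacent to cyc r and cyc (r + d), 1 ≤ d, d + 2 ≤ m,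
  -- would close the shorter cycle x, cyc r, …, cyc (r + d).
  noShortcut : ∀ {x} → (∀ t → cyc t ≢ x) → ∀ r d → 1 ≤ d → suc (suc d) ≤ m →
               Adj G (cyc r) x → Adj G (cyc (r + d)) x → ⊥
  noShortcut {x} off r d 1≤d d+2≤m a b =
    shorter (closedPath⇒Cycle G (suc (suc d)) (s≤s (s≤s 1≤d)) f inj step b) d+2≤m
    where
    f : ℕ → Fin n
    f zero    = x
    f (suc s) = cyc (r + s)
    d<g : d < suc m
    d<g = ≤-trans (n≤1+n (suc d)) (≤-trans d+2≤m (n≤1+n m))
    inj : ∀ {s t} → s < suc (suc d) → t < suc (suc d) → f s ≡ f t → s ≡ t
    inj {zero}  {zero}  _   _   _ = refl
    inj {zero}  {suc t} _   _   e = ⊥-elim (off (r + t) (sym e))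
    inj {suc s} {zero}  _   _   e = ⊥-elim (off (r + s) e)
    inj {suc s} {suc t} s<L t<L e =
      cong suc (arc-injective r (≤-trans (s≤s⁻¹ s<L) d<g) (≤-trans (s≤s⁻¹ t<L) d<g) e)
    step : ∀ {s} → suc s < suc (suc d) → Adj G (f s) (f (suc s))
    step {zero}  _ = subst (λ t → Adj G x (cyc t)) (sym (+-identityʳ r)) (adj-sym G a)
    step {suc s} _ = arc-step r s

  -- If positions
  -- i and i + d shared one, it would close a cycle through the shorter of the two
  -- arcs between them, of length at most g / 2 + 2 < g.
  out-distinct : ∀ i d → 1 ≤ d → d ≤ m → out i ≢ out (i + d)
  out-distinct i d 1≤d d≤m same with suc (suc d) ≤? m
  ... | yes d+2≤m = noShortcut (offCycle i) i d 1≤d d+2≤m (out-adj i)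
                      (subst (Adj G (cyc (i + d))) (sym same) (out-adj (i + d)))
  ... | no  d+2≰m with m≤n⇒∃[o]m+o≡n (m≤n⇒m≤1+n d≤m)
  ...   | zero , d≡g = <-irrefl refl (subst (_≤ m) (trans (sym (+-identityʳ d)) d≡g) d≤m)
  ...   | d′@(suc _) , d+d′≡g =
    noShortcut (offCycle (i + d)) (i + d) d′ (s≤s z≤n) d′+2≤m (out-adj (i + d)) wrapAround
    where
    d′≤2 : d′ ≤ 2
    d′≤2 = +-cancelˡ-≤ d d′ 2 (≤-trans (≤-reflexive d+d′≡g) (≤-trans (≰⇒> d+2≰m) (≤-reflexive (+-comm 2 d))))
    d′+2≤m : suc (suc d′) ≤ m
    d′+2≤m = ≤-trans (s≤s (s≤s d′≤2)) 4≤m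
    backToStart : cyc (i + d + d′) ≡ cyc i
    backToStart = cyc-cong (i + d + d′) i
      (trans (cong (_% suc m) (trans (+-assoc i d d′) (cong (i +_) d+d′≡g))) ([m+n]%n≡m%n i (suc m)))
    wrapAround : Adj G (cyc (i + d + d′)) (out (i + d))
    wrapAround = subst₂ (Adj G) (sym backToStart) same (out-adj i)

  cycleAndOutward : List (Fin n)
  cycleAndOutward = applyUpTo cyc (suc m) ++ applyUpTo out (suc m)

  cycleAndOutward-unique : Unique cycleAndOutward
  cycleAndOutward-unique =
    ++⁺ (applyUpTo⁺₁ cyc (suc m) cyc-distinct) (applyUpTo⁺₁ out (suc m) outs-distinct) apart
    where
    cyc-distinct : ∀ {i j} → i < j → j < suc m → cyc i ≢ cyc j
    cyc-distinct i<j j<g e = <⇒≢ i<j (arc-injective 0 (<-trans i<j j<g) j<g e)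
    outs-distinct : ∀ {i j} → i < j → j < suc m → out i ≢ out j
    outs-distinct {i} {j} i<j j<g with o , refl ← m≤n⇒∃[o]m+o≡n i<j =
      subst (λ t → out i ≢ out t) (+-suc i o) (out-distinct i (suc o) (s≤s z≤n) o<g)
      where
      o<g : suc o ≤ m
      o<g = ≤-trans (m≤n+m (suc o) i) (≤-trans (≤-reflexive (+-suc i o)) (s≤s⁻¹ j<g))
    apart : Disjoint (applyUpTo cyc (suc m)) (applyUpTo out (suc m))
    apart (p , q) with ∈-applyUpTo⁻ cyc p | ∈-applyUpTo⁻ out q
    ... | t , _ , refl | i , _ , e = offCycle i t e

  twiceGirth≤n : 2 * g ≤ n
  twiceGirth≤n = subst (_≤ n) count (unique⇒length≤ cycleAndOutward-unique)
    where
    count : length cycleAndOutward ≡ 2 * g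
    count = begin
      length cycleAndOutward ≡⟨ length-++ (applyUpTo cyc (suc m)) ⟩
      length (applyUpTo cyc (suc m)) + length (applyUpTo out (suc m))
        ≡⟨ cong₂ _+_ (length-applyUpTo cyc (suc m)) (length-applyUpTo out (suc m)) ⟩
      suc m + suc m ≡⟨ cong (λ x → x + x) (sym ℓ≡) ⟩
      g + g ≡⟨ cong (g +_) (+-identityʳ g) ⟨
      2 * g ∎
      where open ≡-Reasoning

lemma6p1 : ∀ (n k D g : ℕ) (G : Graph n) → IsConnected G → IsRegular G k → 3 ≤ k
             → Diameter G D → 3 ≤ D → Girth G g → 2 * g ≤ n
lemma6p1 n k D g G _ regular 3≤k (_ , u , v , distance) 3≤D (C , minimal) with g ≤? 4
... | no  g≰4 = ShortestCycle.twiceGirth≤n (λ i → subst (3 ≤_) (sym (regular i)) 3≤k) C minimal (≰⇒> g≰4)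
... | yes g≤4 = begin
  2 * g                              ≤⟨ *-monoʳ-≤ 2 (≤-trans g≤4 (s≤s 3≤k)) ⟩
  2 * suc k                          ≡⟨ cong (suc k +_) (+-identityʳ (suc k)) ⟩
  suc k + suc k                      ≡⟨ cong₂ (λ a b → suc a + suc b) (regular u) (regular v) ⟨
  suc (degree G u) + suc (degree G v) ≤⟨ farApart G (distance≥3⇒noShortWalk G distance 3≤D) ⟩
  n                                  ∎
  where open ≤-Reasoning
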